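{- Let $r\ge0$ be an integer and for $n\ge0$ let $\mathcal{D}_{n,r}(x)=\sum_{k=0}^n\binom nk\binom{k+r}{k}k!\,(x-1)^{n-k}$ be the $r$-derangement polynomials. Let $n\ge1$, $s\ge1$, $m\ge0$ be integers and $p\ge3$ a prime. Then $$\mathcal{D}_{n+mp^s,r}(x)\equiv\left(x^{p^s}-1\right)^m\mathcal{D}_{n,r}(x)\pmod p.$$ In particular $\mathcal{D}_{n+2p,r}(0)\equiv\mathcal{D}_{n,r}(0)\pmod p$ and $\mathcal{D}_{n+p,r}(2)\equiv\mathcal{D}_{n,r}(2)\pmod p$.
   Context: A congruence $P(x)\equiv Q(x)\pmod p$ between polynomials with integer coefficients means that every coefficient of $P(x)-Q(x)$ is divisible by $p$. The $r$-derangement polynomials have exponential generating function $\sum_n\mathcal{D}_{n,r}(x)\frac{t^n}{n!}=\frac{e^{ -t}}{(1-t)^{r+1}}e^{xt}$, and $\mathcal{D}_{n,r}(x)=\sum_{k=0}^n\binom nk\mathcal{D}_{n-k,r}(0)x^k$. -}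

module Defs where

open import Data.Nat as ℕ using (ℕ; zero; suc)
open import Data.Nat.Combinatorics using (_C_)
open import Data.Nat.Base using (_!)
open import Data.Integer as ℤ using (ℤ; +_)
open import Data.Integer.Divisibility using (_∣_)
open import Data.List using (List; []; _∷_; upTo; map; foldr)

-- Polynomials with integer coefficients, as coefficient lists
-- (constant coefficient first). Trailing zeros are allowed; all notions
-- below are via `coeff`, so they do not depend on trailing zeros.
Poly : Set
Poly = List ℤ

coeff : Poly → ℕ → ℤ
coeff []       _       = + 0
coeff (a ∷ _)  zero    = a
coeff (_ ∷ as) (suc k) = coeff as k

const : ℤ → Poly
const c = c ∷ []

X : Poly
X = + 0 ∷ + 1 ∷ []

infixl 6 _⊕_
infixl 7 _⊛_ _·_

_⊕_ : Poly → Poly → Poly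
[]       ⊕ q        = q
p        ⊕ []       = p
(a ∷ as) ⊕ (b ∷ bs) = (a ℤ.+ b) ∷ (as ⊕ bs)

_·_ : ℤ → Poly → Poly
c · q = map (c ℤ.*_) q

_⊛_ : Poly → Poly → Poly
[]       ⊛ q = []
(a ∷ as) ⊛ q = (a · q) ⊕ (+ 0 ∷ (as ⊛ q))

_^ₚ_ : Poly → ℕ → Poly
p ^ₚ zero  = const (+ 1)
p ^ₚ suc n = p ⊛ (p ^ₚ n)

_≡ₚ_[mod_] : Poly → Poly → ℕ → Set
P ≡ₚ Q [mod p ] = ∀ k → (+ p) ∣ (coeff P k ℤ.- coeff Q k)

derangePoly : ℕ → ℕ → Poly
derangePoly n r =
  foldr _⊕_ []
    (map (λ k → (+ ((n C k) ℕ.* ((k ℕ.+ r) C k) ℕ.* (k !)))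
                 · ((X ⊕ const (ℤ.- (+ 1))) ^ₚ (n ℕ.∸ k)))
         (upTo (suc n)))

module Submission where

-- Write D_{n,r} = Σ_k c(n,k) (x-1)^(n-k) with c(n,k) = C(n,k) C(k+r,k) k!.  If p ∣ M then
-- c(n+M,k) ≡ c(n,k) (mod p) for every k: for k ≥ p both sides are divisible by k!, and for
-- k < p Pascal's rule and p ∣ C(M,i) (0 < i < p) give C(n+M,k) ≡ C(n,k).  Hence the terms
-- with k > n vanish mod p, and (x-1)^(n+M-k) = (x-1)^M (x-1)^(n-k) for k ≤ n, so
-- D_{n+M,r} ≡ (x-1)^M D_{n,r}.  For M = m p^s it remains to note (x-1)^(p^s) ≡ x^(p^s) - 1,
-- as p ∣ C(p^s,j) for 0 < j < p^s and p^s is odd.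

open import Defs
open import Data.List using ([]; _∷_; foldr; applyUpTo)
open import Data.List.Properties using (map-upTo)
open import Data.Nat as ℕ using (ℕ; zero; suc; _<_; _≤_; _∸_; _^_; _!; s≤s; z≤n)
import Data.Nat.Properties as ℕP
open import Data.Nat.Combinatorics using (_C_; nC1≡n; nCn≡1; k>n⇒nCk≡0; nCk+nC[k+1]≡[n+1]C[k+1])
open import Data.Nat.Divisibility
  using (_∣_; _∣0; divides; _∣?_; ∣-refl; ∣-trans; 1∣_; m∣m*n; ∣n⇒∣m*n; ∣⇒≤; m*n∣⇒m∣; *-monoʳ-∣; *-cancelˡ-∣; m≤n⇒m!∣n!)
open import Data.Nat.Primality using (Prime; composite; euclidsLemma; prime⇒nonZero)
open import Data.Product using (∃-syntax; _,_)
open import Data.Sum using (inj₁; inj₂)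
open import Relation.Binary.Bundles using (Setoid)
open import Relation.Binary.Definitions using (tri<; tri≈; tri>)
open import Relation.Binary.PropositionalEquality
open import Function using (_∘_)
import Relation.Binary.Reasoning.Setoid as SetoidReasoning
import Data.Integer.Divisibility.Signed as ℤ∣
open import Relation.Nullary using (¬_; yes; no; contradiction)

module _ where

  open import Data.Nat using (_+_; _*_; NonZero)
  open import Data.Nat.Properties using (+-identityʳ; *-identityʳ; *-zeroʳ; *-comm; *-assoc; <⇒≱)
  open import Data.Nat.DivMod using (_/_; _%_; m≡m%n+[m/n]*n; m%n<n)
  open import Data.Nat.Tactic.RingSolver using (solve-∀)

  [1+k]*[1+n]C[1+k]≡[1+n]*nCk : ∀ n k → suc k * (suc n C suc k) ≡ suc n * (n C k)
  [1+k]*[1+n]C[1+k]≡[1+n]*nCk zero    zero    = refl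
  [1+k]*[1+n]C[1+k]≡[1+n]*nCk zero    (suc k) = *-zeroʳ (2 + k)
  [1+k]*[1+n]C[1+k]≡[1+n]*nCk (suc n) zero    =
    trans (+-identityʳ _) (trans (nC1≡n (2 + n)) (sym (*-identityʳ (2 + n))))
  [1+k]*[1+n]C[1+k]≡[1+n]*nCk (suc n) (suc k) = begin
    (2 + k) * ((2 + n) C (2 + k)) ≡⟨ cong ((2 + k) *_) (nCk+nC[k+1]≡[n+1]C[k+1] (suc n) (suc k)) ⟨
    (2 + k) * (A + B)                          ≡⟨ split-factor k A B ⟩
    (1 + k) * A + A + (2 + k) * B              ≡⟨ cong₂ (λ u v → u + A + v) ([1+k]*[1+n]C[1+k]≡[1+n]*nCk n k) ([1+k]*[1+n]C[1+k]≡[1+n]*nCk n (suc k)) ⟩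
    (1 + n) * (n C k) + A + (1 + n) * (n C suc k) ≡⟨ collect n A (n C k) (n C suc k) ⟩
    (1 + n) * (n C k + n C suc k) + A          ≡⟨ cong (λ u → (1 + n) * u + A) (nCk+nC[k+1]≡[n+1]C[k+1] n k) ⟩
    (1 + n) * A + A                            ≡⟨ collect′ n A ⟩
    (2 + n) * A                                ∎
    where
    open ≡-Reasoning
    A = suc n C suc k
    B = suc n C suc (suc k)
    split-factor : ∀ k a b → (2 + k) * (a + b) ≡ (1 + k) * a + a + (2 + k) * b
    split-factor = solve-∀
    collect : ∀ n a x y → (1 + n) * x + a + (1 + n) * y ≡ (1 + n) * (x + y) + a
    collect = solve-∀
    collect′ : ∀ n a → (1 + n) * a + a ≡ (2 + n) * a
    collect′ = solve-∀

  n∣[1+k]*nC[1+k] : ∀ n k → n ∣ suc k * (n C suc k)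
  n∣[1+k]*nC[1+k] zero    k = subst (0 ∣_) (sym (*-zeroʳ (suc k))) ∣-refl
  n∣[1+k]*nC[1+k] (suc n) k =
    subst (suc n ∣_) (sym ([1+k]*[1+n]C[1+k]≡[1+n]*nCk n k)) (m∣m*n (n C k))

  ∣n⇒∣nCk : ∀ {p n k} → Prime p → p ∣ n → 0 < k → k < p → p ∣ n C k
  ∣n⇒∣nCk {p} {n} {suc k} p-prime p∣n _ k<p
    with euclidsLemma (suc k) (n C suc k) p-prime (∣-trans p∣n (n∣[1+k]*nC[1+k] n k))
  ... | inj₁ p∣k = contradiction (∣⇒≤ p∣k) (<⇒≱ k<p)
  ... | inj₂ p∣C = p∣C

  p^t∣m*n⇒p^t∣m : ∀ {p} → Prime p → ∀ t {m n} → ¬ p ∣ n → p ^ t ∣ m * n → p ^ t ∣ m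
  p^t∣m*n⇒p^t∣m {p} p-prime zero    {m}     p∤n _ = 1∣ m
  p^t∣m*n⇒p^t∣m {p} p-prime (suc t) {m} {n} p∤n p^[1+t]∣mn
    with euclidsLemma m n p-prime (m*n∣⇒m∣ p (p ^ t) p^[1+t]∣mn)
  ... | inj₂ p∣n = contradiction p∣n p∤n
  ... | inj₁ (divides q refl) = subst (p * p ^ t ∣_) (*-comm p q) (*-monoʳ-∣ p p^t∣q)
    where
    instance _ = prime⇒nonZero p-prime
    p^t∣q : p ^ t ∣ q
    p^t∣q = p^t∣m*n⇒p^t∣m p-prime t p∤n
      (*-cancelˡ-∣ p (subst (p * p ^ t ∣_) (trans (cong (_* n) (*-comm q p)) (*-assoc p q n)) p^[1+t]∣mn))

  p∣[p^s]Ck : ∀ {p} → Prime p → ∀ s k → 0 < k → k < p ^ s → p ∣ (p ^ s) C k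
  p∣[p^s]Ck {p} p-prime s (suc k) _ k<p^s with p ∣? (p ^ s) C suc k
  ... | yes p∣C = p∣C
  ... | no  p∤C = contradiction (∣⇒≤ (p^t∣m*n⇒p^t∣m p-prime s p∤C (n∣[1+k]*nC[1+k] (p ^ s) k))) (<⇒≱ k<p^s)

  m≤n⇒m∣n! : ∀ {m n} → .{{NonZero m}} → m ≤ n → m ∣ n !
  m≤n⇒m∣n! {suc m} m≤n = ∣-trans (m∣m*n (m !)) (m≤n⇒m!∣n! m≤n)

  odd-prime : ∀ {p} → Prime p → 2 < p → ∃[ q ] p ≡ 1 + 2 * q
  odd-prime {p} p-prime 2<p with p % 2 | m≡m%n+[m/n]*n p 2 | m%n<n p 2
  ... | 0 | p≡[p/2]*2 | _ = contradiction (composite 2<p (divides (p / 2) p≡[p/2]*2)) (Prime.notComposite p-prime)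
  ... | 1 | p≡1+[p/2]*2 | _ = p / 2 , trans p≡1+[p/2]*2 (cong suc (*-comm (p / 2) 2))
  ... | suc (suc _) | _ | s≤s (s≤s ())

module _ where

  open import Data.Integer as ℤ using (ℤ; +_; -_; _+_; _*_; _-_; -1ℤ)
  import Data.Integer.Properties as ℤP
  open import Data.Integer.Tactic.RingSolver using (solve-∀)

  infix 4 _≋_
  record _≋_ (P Q : Poly) : Set where
    field coeff-≡ : ∀ k → coeff P k ≡ coeff Q k
  open _≋_

  ≋-refl : ∀ {P} → P ≋ P
  ≋-refl .coeff-≡ k = refl

  ≋-sym : ∀ {P Q} → P ≋ Q → Q ≋ P
  ≋-sym e .coeff-≡ k = sym (coeff-≡ e k)

  ≋-trans : ∀ {P Q R} → P ≋ Q → Q ≋ R → P ≋ R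
  ≋-trans e f .coeff-≡ k = trans (coeff-≡ e k) (coeff-≡ f k)

  ≋-setoid : Setoid _ _
  ≋-setoid = record
    { Carrier = Poly ; _≈_ = _≋_
    ; isEquivalence = record { refl = ≋-refl ; sym = ≋-sym ; trans = ≋-trans } }

  module ≋-Reasoning = SetoidReasoning ≋-setoid

  shift : Poly → Poly
  shift P = + 0 ∷ P

  coeff-⊕ : ∀ P Q k → coeff (P ⊕ Q) k ≡ coeff P k + coeff Q k
  coeff-⊕ []      Q       k       = sym (ℤP.+-identityˡ _)
  coeff-⊕ (a ∷ P) []      k       = sym (ℤP.+-identityʳ _)
  coeff-⊕ (a ∷ P) (b ∷ Q) zero    = refl
  coeff-⊕ (a ∷ P) (b ∷ Q) (suc k) = coeff-⊕ P Q k

  coeff-· : ∀ c Q k → coeff (c · Q) k ≡ c * coeff Q k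
  coeff-· c []      k       = sym (ℤP.*-zeroʳ c)
  coeff-· c (a ∷ Q) zero    = refl
  coeff-· c (a ∷ Q) (suc k) = coeff-· c Q k

  coeff-·⊕ : ∀ c P R k → coeff (c · P ⊕ R) k ≡ c * coeff P k + coeff R k
  coeff-·⊕ c P R k = trans (coeff-⊕ (c · P) R k) (cong (_+ coeff R k) (coeff-· c P k))

  coeff-∷⊛ : ∀ a P Q k → coeff ((a ∷ P) ⊛ Q) k ≡ a * coeff Q k + coeff (shift (P ⊛ Q)) k
  coeff-∷⊛ a P Q = coeff-·⊕ a Q (shift (P ⊛ Q))

  ⊕-cong : ∀ {P P' Q Q'} → P ≋ P' → Q ≋ Q' → P ⊕ Q ≋ P' ⊕ Q'
  ⊕-cong {P} {P'} {Q} {Q'} e f .coeff-≡ k = begin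
    coeff (P ⊕ Q) k           ≡⟨ coeff-⊕ P Q k ⟩
    coeff P k + coeff Q k     ≡⟨ cong₂ _+_ (coeff-≡ e k) (coeff-≡ f k) ⟩
    coeff P' k + coeff Q' k   ≡⟨ coeff-⊕ P' Q' k ⟨
    coeff (P' ⊕ Q') k         ∎
    where open ≡-Reasoning

  ·-cong : ∀ c {Q Q'} → Q ≋ Q' → c · Q ≋ c · Q'
  ·-cong c {Q} {Q'} e .coeff-≡ k = begin
    coeff (c · Q) k    ≡⟨ coeff-· c Q k ⟩
    c * coeff Q k      ≡⟨ cong (c *_) (coeff-≡ e k) ⟩
    c * coeff Q' k     ≡⟨ coeff-· c Q' k ⟨
    coeff (c · Q') k   ∎
    where open ≡-Reasoning

  shift-cong : ∀ {P Q} → P ≋ Q → shift P ≋ shift Q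
  shift-cong e .coeff-≡ zero    = refl
  shift-cong e .coeff-≡ (suc k) = coeff-≡ e k

  ⊕-identityʳ : ∀ P → P ⊕ [] ≋ P
  ⊕-identityʳ P .coeff-≡ k = trans (coeff-⊕ P [] k) (ℤP.+-identityʳ _)

  ⊕-assoc : ∀ P Q R → (P ⊕ Q) ⊕ R ≋ P ⊕ (Q ⊕ R)
  ⊕-assoc P Q R .coeff-≡ k = begin
    coeff ((P ⊕ Q) ⊕ R) k                   ≡⟨ coeff-⊕ (P ⊕ Q) R k ⟩
    coeff (P ⊕ Q) k + coeff R k             ≡⟨ cong (_+ coeff R k) (coeff-⊕ P Q k) ⟩
    coeff P k + coeff Q k + coeff R k       ≡⟨ ℤP.+-assoc (coeff P k) (coeff Q k) (coeff R k) ⟩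
    coeff P k + (coeff Q k + coeff R k)     ≡⟨ cong (_+_ (coeff P k)) (coeff-⊕ Q R k) ⟨
    coeff P k + coeff (Q ⊕ R) k             ≡⟨ coeff-⊕ P (Q ⊕ R) k ⟨
    coeff (P ⊕ (Q ⊕ R)) k                   ∎
    where open ≡-Reasoning

  ⊛-congʳ : ∀ P {Q Q'} → Q ≋ Q' → P ⊛ Q ≋ P ⊛ Q'
  ⊛-congʳ []      e = ≋-refl
  ⊛-congʳ (a ∷ P) e = ⊕-cong (·-cong a e) (shift-cong (⊛-congʳ P e))

  ⊛-zeroʳ : ∀ P → P ⊛ [] ≋ []
  ⊛-zeroʳ []      = ≋-refl
  ⊛-zeroʳ (a ∷ P) .coeff-≡ zero    = refl
  ⊛-zeroʳ (a ∷ P) .coeff-≡ (suc k) = coeff-≡ (⊛-zeroʳ P) k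

  ⊛-∷ʳ : ∀ P a Q → P ⊛ (a ∷ Q) ≋ a · P ⊕ shift (P ⊛ Q)
  ⊛-∷ʳ []      a Q .coeff-≡ zero    = refl
  ⊛-∷ʳ []      a Q .coeff-≡ (suc k) = refl
  ⊛-∷ʳ (b ∷ P) a Q .coeff-≡ zero    = begin
    b * a + + 0   ≡⟨ cong (_+ + 0) (ℤP.*-comm b a) ⟩
    a * b + + 0   ≡⟨ coeff-⊕ (a · (b ∷ P)) (shift ((b ∷ P) ⊛ Q)) 0 ⟨
    coeff (a · (b ∷ P) ⊕ shift ((b ∷ P) ⊛ Q)) 0 ∎
    where open ≡-Reasoning
  ⊛-∷ʳ (b ∷ P) a Q .coeff-≡ (suc k) = begin
    coeff ((b ∷ P) ⊛ (a ∷ Q)) (suc k)        ≡⟨ coeff-∷⊛ b P (a ∷ Q) (suc k) ⟩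
    b * qₖ + coeff (P ⊛ (a ∷ Q)) k            ≡⟨ cong (_+_ (b * qₖ)) (coeff-≡ (⊛-∷ʳ P a Q) k) ⟩
    b * qₖ + coeff (a · P ⊕ shift (P ⊛ Q)) k  ≡⟨ cong (_+_ (b * qₖ)) (coeff-·⊕ a P _ k) ⟩
    b * qₖ + (a * pₖ + sₖ)                    ≡⟨ swap b a qₖ pₖ sₖ ⟩
    a * pₖ + (b * qₖ + sₖ)                    ≡⟨ cong (_+_ (a * pₖ)) (coeff-∷⊛ b P Q k) ⟨
    a * pₖ + coeff ((b ∷ P) ⊛ Q) k            ≡⟨ coeff-·⊕ a P _ k ⟨
    coeff (a · (b ∷ P) ⊕ shift ((b ∷ P) ⊛ Q)) (suc k) ∎
    where
    open ≡-Reasoning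
    qₖ = coeff Q k
    pₖ = coeff P k
    sₖ = coeff (shift (P ⊛ Q)) k
    swap : ∀ b a q p s → b * q + (a * p + s) ≡ a * p + (b * q + s)
    swap = solve-∀

  ⊛-comm : ∀ P Q → P ⊛ Q ≋ Q ⊛ P
  ⊛-comm []      Q = ≋-sym (⊛-zeroʳ Q)
  ⊛-comm (a ∷ P) Q = ≋-trans (⊕-cong {a · Q} ≋-refl (shift-cong (⊛-comm P Q))) (≋-sym (⊛-∷ʳ Q a P))

  ⊛-distribʳ : ∀ P Q R → (P ⊕ Q) ⊛ R ≋ P ⊛ R ⊕ Q ⊛ R
  ⊛-distribʳ []      Q       R = ≋-refl
  ⊛-distribʳ (a ∷ P) []      R = ≋-sym (⊕-identityʳ _)
  ⊛-distribʳ (a ∷ P) (b ∷ Q) R .coeff-≡ k = begin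
    coeff ((a + b ∷ P ⊕ Q) ⊛ R) k                            ≡⟨ coeff-∷⊛ (a + b) (P ⊕ Q) R k ⟩
    (a + b) * rₖ + coeff (shift ((P ⊕ Q) ⊛ R)) k             ≡⟨ cong (_+_ ((a + b) * rₖ)) (coeff-≡ (shift-cong (⊛-distribʳ P Q R)) k) ⟩
    (a + b) * rₖ + coeff (shift (P ⊛ R) ⊕ shift (Q ⊛ R)) k   ≡⟨ cong (_+_ ((a + b) * rₖ)) (coeff-⊕ (shift (P ⊛ R)) (shift (Q ⊛ R)) k) ⟩
    (a + b) * rₖ + (coeff (shift (P ⊛ R)) k + coeff (shift (Q ⊛ R)) k) ≡⟨ distrib a b rₖ _ _ ⟩
    (a * rₖ + coeff (shift (P ⊛ R)) k) + (b * rₖ + coeff (shift (Q ⊛ R)) k)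
      ≡⟨ cong₂ _+_ (coeff-∷⊛ a P R k) (coeff-∷⊛ b Q R k) ⟨
    coeff ((a ∷ P) ⊛ R) k + coeff ((b ∷ Q) ⊛ R) k            ≡⟨ coeff-⊕ ((a ∷ P) ⊛ R) _ k ⟨
    coeff ((a ∷ P) ⊛ R ⊕ (b ∷ Q) ⊛ R) k                      ∎
    where
    open ≡-Reasoning
    rₖ = coeff R k
    distrib : ∀ a b r x y → (a + b) * r + (x + y) ≡ (a * r + x) + (b * r + y)
    distrib = solve-∀

  ⊛-distribˡ : ∀ P Q R → P ⊛ (Q ⊕ R) ≋ P ⊛ Q ⊕ P ⊛ R
  ⊛-distribˡ P Q R = ≋-trans (⊛-comm P (Q ⊕ R))
    (≋-trans (⊛-distribʳ Q R P) (⊕-cong (⊛-comm Q P) (⊛-comm R P)))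

  coeff-shift-· : ∀ c P k → coeff (shift (c · P)) k ≡ c * coeff (shift P) k
  coeff-shift-· c P zero    = sym (ℤP.*-zeroʳ c)
  coeff-shift-· c P (suc k) = coeff-· c P k

  ·-zeroˡ : ∀ Q → + 0 · Q ≋ []
  ·-zeroˡ Q .coeff-≡ k = trans (coeff-· (+ 0) Q k) (ℤP.*-zeroˡ (coeff Q k))

  ·-identityˡ : ∀ Q → + 1 · Q ≋ Q
  ·-identityˡ Q .coeff-≡ k = trans (coeff-· (+ 1) Q k) (ℤP.*-identityˡ (coeff Q k))

  shift-[] : shift [] ≋ []
  shift-[] .coeff-≡ zero    = refl
  shift-[] .coeff-≡ (suc k) = refl

  ·-⊛ : ∀ c Q R → (c · Q) ⊛ R ≋ c · (Q ⊛ R)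
  ·-⊛ c []      R = ≋-refl
  ·-⊛ c (a ∷ Q) R .coeff-≡ k = begin
    coeff ((c * a ∷ c · Q) ⊛ R) k                        ≡⟨ coeff-∷⊛ (c * a) (c · Q) R k ⟩
    c * a * coeff R k + coeff (shift ((c · Q) ⊛ R)) k    ≡⟨ cong (_+_ (c * a * coeff R k)) (coeff-≡ (shift-cong (·-⊛ c Q R)) k) ⟩
    c * a * coeff R k + coeff (shift (c · (Q ⊛ R))) k    ≡⟨ cong₂ _+_ (ℤP.*-assoc c a (coeff R k)) (coeff-shift-· c (Q ⊛ R) k) ⟩
    c * (a * coeff R k) + c * coeff (shift (Q ⊛ R)) k    ≡⟨ ℤP.*-distribˡ-+ c _ _ ⟨
    c * (a * coeff R k + coeff (shift (Q ⊛ R)) k)        ≡⟨ cong (c *_) (coeff-∷⊛ a Q R k) ⟨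
    c * coeff ((a ∷ Q) ⊛ R) k                            ≡⟨ coeff-· c ((a ∷ Q) ⊛ R) k ⟨
    coeff (c · ((a ∷ Q) ⊛ R)) k                          ∎
    where open ≡-Reasoning

  ⊛-· : ∀ c P Q → P ⊛ (c · Q) ≋ c · (P ⊛ Q)
  ⊛-· c P Q = ≋-trans (⊛-comm P (c · Q)) (≋-trans (·-⊛ c Q P) (·-cong c (⊛-comm Q P)))

  shift-⊛ : ∀ P R → shift P ⊛ R ≋ shift (P ⊛ R)
  shift-⊛ P R .coeff-≡ k = trans (coeff-∷⊛ (+ 0) P R k) (ℤP.+-identityˡ _)

  ⊛-assoc : ∀ P Q R → (P ⊛ Q) ⊛ R ≋ P ⊛ (Q ⊛ R)
  ⊛-assoc []      Q R = ≋-refl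
  ⊛-assoc (a ∷ P) Q R = begin
    (a · Q ⊕ shift (P ⊛ Q)) ⊛ R           ≈⟨ ⊛-distribʳ (a · Q) (shift (P ⊛ Q)) R ⟩
    (a · Q) ⊛ R ⊕ shift (P ⊛ Q) ⊛ R       ≈⟨ ⊕-cong (·-⊛ a Q R) (shift-⊛ (P ⊛ Q) R) ⟩
    a · (Q ⊛ R) ⊕ shift ((P ⊛ Q) ⊛ R)     ≈⟨ ⊕-cong {a · (Q ⊛ R)} ≋-refl (shift-cong (⊛-assoc P Q R)) ⟩
    a · (Q ⊛ R) ⊕ shift (P ⊛ (Q ⊛ R))     ∎
    where open ≋-Reasoning

  ⊛-identityˡ : ∀ Q → const (+ 1) ⊛ Q ≋ Q
  ⊛-identityˡ Q = ≋-trans (⊕-cong (·-identityˡ Q) shift-[]) (⊕-identityʳ Q)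

  ^ₚ-distribˡ-+-⊛ : ∀ P a b → P ^ₚ (a ℕ.+ b) ≋ P ^ₚ a ⊛ P ^ₚ b
  ^ₚ-distribˡ-+-⊛ P zero    b = ≋-sym (⊛-identityˡ (P ^ₚ b))
  ^ₚ-distribˡ-+-⊛ P (suc a) b = ≋-trans (⊛-congʳ P (^ₚ-distribˡ-+-⊛ P a b)) (≋-sym (⊛-assoc P (P ^ₚ a) (P ^ₚ b)))

  ^ₚ-*-assoc : ∀ P m n → P ^ₚ (m ℕ.* n) ≋ (P ^ₚ n) ^ₚ m
  ^ₚ-*-assoc P zero    n = ≋-refl
  ^ₚ-*-assoc P (suc m) n = ≋-trans (^ₚ-distribˡ-+-⊛ P n (m ℕ.* n)) (⊛-congʳ (P ^ₚ n) (^ₚ-*-assoc P m n))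

  X⊛≋shift : ∀ Q → X ⊛ Q ≋ shift Q
  X⊛≋shift Q = ⊕-cong (·-zeroˡ Q) (shift-cong (⊛-identityˡ Q))

  coeff-X^-diagonal : ∀ L → coeff (X ^ₚ L) L ≡ + 1
  coeff-X^-diagonal zero    = refl
  coeff-X^-diagonal (suc L) = trans (coeff-≡ (X⊛≋shift (X ^ₚ L)) (suc L)) (coeff-X^-diagonal L)

  coeff-X^-off-diagonal : ∀ L j → j ≢ L → coeff (X ^ₚ L) j ≡ + 0
  coeff-X^-off-diagonal zero    zero    j≢L = contradiction refl j≢L
  coeff-X^-off-diagonal zero    (suc j) j≢L = refl
  coeff-X^-off-diagonal (suc L) zero    j≢L = coeff-≡ (X⊛≋shift (X ^ₚ L)) 0
  coeff-X^-off-diagonal (suc L) (suc j) j≢L =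
    trans (coeff-≡ (X⊛≋shift (X ^ₚ L)) (suc j)) (coeff-X^-off-diagonal L j (j≢L ∘ cong suc))

  infix 8 -1^_
  -1^_ : ℕ → ℤ
  -1^ n = -1ℤ ℤ.^ n

  -1^[p^s]≡-1 : ∀ {p} → Prime p → 2 < p → ∀ s → -1^ (p ^ s) ≡ -1ℤ
  -1^[p^s]≡-1 {p} p-prime 2<p zero    = refl
  -1^[p^s]≡-1 {p} p-prime 2<p (suc s) = begin
    -1^ (p ℕ.* p ^ s)       ≡⟨ cong -1^_ (ℕP.*-comm p (p ^ s)) ⟩
    -1^ (p ^ s ℕ.* p)       ≡⟨ ℤP.^-*-assoc -1ℤ (p ^ s) p ⟨
    (-1^ (p ^ s)) ℤ.^ p     ≡⟨ cong (ℤ._^ p) (-1^[p^s]≡-1 p-prime 2<p s) ⟩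
    -1^ p                   ≡⟨ -1^p≡-1 ⟩
    -1ℤ                     ∎
    where
    open ≡-Reasoning
    -1^p≡-1 : -1^ p ≡ -1ℤ
    -1^p≡-1 with odd-prime p-prime 2<p
    ... | q , refl = cong (-1ℤ *_) (trans (sym (ℤP.^-*-assoc -1ℤ 2 q)) (ℤP.^-zeroˡ q))

  X-1 : Poly
  X-1 = X ⊕ const (- + 1)

  X-1⊛≋ : ∀ Q → X-1 ⊛ Q ≋ -1ℤ · Q ⊕ shift Q
  X-1⊛≋ Q = ⊕-cong { -1ℤ · Q} ≋-refl (shift-cong (⊛-identityˡ Q))

  coeff-X-1^ : ∀ N j → coeff (X-1 ^ₚ N) j ≡ -1^ (N ℕ.+ j) * + (N C j)
  coeff-X-1^ zero    zero    = refl
  coeff-X-1^ zero    (suc j) = sym (ℤP.*-zeroʳ (-1^ suc j))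
  coeff-X-1^ (suc N) zero    = begin
    coeff (X-1 ⊛ X-1 ^ₚ N) 0                  ≡⟨ coeff-≡ (X-1⊛≋ (X-1 ^ₚ N)) 0 ⟩
    coeff (-1ℤ · X-1 ^ₚ N ⊕ shift (X-1 ^ₚ N)) 0 ≡⟨ coeff-·⊕ -1ℤ (X-1 ^ₚ N) _ 0 ⟩
    -1ℤ * coeff (X-1 ^ₚ N) 0 + + 0             ≡⟨ ℤP.+-identityʳ _ ⟩
    -1ℤ * coeff (X-1 ^ₚ N) 0                   ≡⟨ cong (-1ℤ *_) (coeff-X-1^ N 0) ⟩
    -1ℤ * (-1^ (N ℕ.+ 0) * + 1)                ≡⟨ ℤP.*-assoc -1ℤ (-1^ (N ℕ.+ 0)) (+ 1) ⟨
    -1^ (suc N ℕ.+ 0) * + 1                    ∎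
    where open ≡-Reasoning
  coeff-X-1^ (suc N) (suc j) = begin
    coeff (X-1 ⊛ X-1 ^ₚ N) (suc j)                    ≡⟨ coeff-≡ (X-1⊛≋ (X-1 ^ₚ N)) (suc j) ⟩
    coeff (-1ℤ · X-1 ^ₚ N ⊕ shift (X-1 ^ₚ N)) (suc j) ≡⟨ coeff-·⊕ -1ℤ (X-1 ^ₚ N) _ (suc j) ⟩
    -1ℤ * coeff (X-1 ^ₚ N) (suc j) + coeff (X-1 ^ₚ N) j
      ≡⟨ cong₂ (λ u v → -1ℤ * u + v) (coeff-X-1^ N (suc j)) (coeff-X-1^ N j) ⟩
    -1ℤ * (-1^ (N ℕ.+ suc j) * + a) + σ * + b          ≡⟨ cong (λ e → -1ℤ * (-1^ e * + a) + σ * + b) (ℕP.+-suc N j) ⟩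
    -1ℤ * (-1ℤ * σ * + a) + σ * + b                    ≡⟨ regroup σ (+ a) (+ b) ⟩
    -1ℤ * (-1ℤ * σ) * (+ b + + a)                      ≡⟨ cong (-1ℤ * (-1ℤ * σ) *_) (ℤP.pos-+ b a) ⟨
    -1ℤ * (-1ℤ * σ) * + (b ℕ.+ a)                      ≡⟨ cong (λ c → -1ℤ * (-1ℤ * σ) * + c) (nCk+nC[k+1]≡[n+1]C[k+1] N j) ⟩
    -1ℤ * (-1ℤ * σ) * + (suc N C suc j)                ≡⟨ cong (λ e → -1ℤ * -1^ e * + (suc N C suc j)) (ℕP.+-suc N j) ⟨
    -1^ (suc N ℕ.+ suc j) * + (suc N C suc j)          ∎
    where
    open ≡-Reasoning
    σ = -1^ (N ℕ.+ j)
    a = N C suc j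
    b = N C j
    regroup : ∀ s a b → -1ℤ * (-1ℤ * s * a) + s * b ≡ -1ℤ * (-1ℤ * s) * (b + a)
    regroup = solve-∀

  Σₚ : (ℕ → Poly) → ℕ → Poly
  Σₚ f n = foldr _⊕_ [] (applyUpTo f n)

  Σₚ-split : ∀ f m n → Σₚ f (m ℕ.+ n) ≋ Σₚ f m ⊕ Σₚ (λ k → f (m ℕ.+ k)) n
  Σₚ-split f zero    n = ≋-refl
  Σₚ-split f (suc m) n = ≋-trans (⊕-cong {f 0} ≋-refl (Σₚ-split (f ∘ suc) m n))
                                 (≋-sym (⊕-assoc (f 0) (Σₚ (f ∘ suc) m) _))

  ⊛-Σₚ : ∀ P f n → P ⊛ Σₚ f n ≋ Σₚ (λ k → P ⊛ f k) n
  ⊛-Σₚ P f zero    = ⊛-zeroʳ P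
  ⊛-Σₚ P f (suc n) = ≋-trans (⊛-distribˡ P (f 0) (Σₚ (f ∘ suc) n))
                             (⊕-cong {P ⊛ f 0} ≋-refl (⊛-Σₚ P (f ∘ suc) n))

  derangeCoeff : ℕ → ℕ → ℕ → ℕ
  derangeCoeff n r k = (n C k) ℕ.* ((k ℕ.+ r) C k) ℕ.* (k !)

  derangeTerm : ℕ → ℕ → ℕ → Poly
  derangeTerm n r k = + derangeCoeff n r k · X-1 ^ₚ (n ∸ k)

  derangePoly≡Σₚ : ∀ n r → derangePoly n r ≡ Σₚ (derangeTerm n r) (suc n)
  derangePoly≡Σₚ n r = cong (foldr _⊕_ []) (map-upTo (derangeTerm n r) (suc n))

  derangeCoeff-vanishes : ∀ {n k} r → n < k → derangeCoeff n r k ≡ 0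
  derangeCoeff-vanishes {n} {k} r n<k = cong (λ c → c ℕ.* ((k ℕ.+ r) C k) ℕ.* (k !)) (k>n⇒nCk≡0 n<k)

  module Modulo (p : ℕ) where

    infix 4 _≡ᵖ_ _≈_

    record _≡ᵖ_ (x y : ℤ) : Set where
      constructor mk≡ᵖ
      field p∣difference : + p ℤ∣.∣ x - y
    open _≡ᵖ_ public

    private
      ∣-resp : ∀ {x y} → x ≡ y → + p ℤ∣.∣ x → + p ℤ∣.∣ y
      ∣-resp = subst (+ p ℤ∣.∣_)

    ≡⇒≡ᵖ : ∀ {x y} → x ≡ y → x ≡ᵖ y
    ≡⇒≡ᵖ {x} refl = mk≡ᵖ (∣-resp (sym (ℤP.+-inverseʳ x)) (ℤ∣.divides (+ 0) refl))

    ∣⇒≡ᵖ0 : ∀ {x} → + p ℤ∣.∣ x → x ≡ᵖ + 0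
    ∣⇒≡ᵖ0 {x} h = mk≡ᵖ (∣-resp (sym (ℤP.+-identityʳ x)) h)

    ≡ᵖ-sym : ∀ {x y} → x ≡ᵖ y → y ≡ᵖ x
    ≡ᵖ-sym {x} {y} (mk≡ᵖ e) = mk≡ᵖ (∣-resp (negate x y) (ℤ∣.∣m⇒∣-m e))
      where
      negate : ∀ x y → - (x - y) ≡ y - x
      negate = solve-∀

    ≡ᵖ-trans : ∀ {x y z} → x ≡ᵖ y → y ≡ᵖ z → x ≡ᵖ z
    ≡ᵖ-trans {x} {y} {z} (mk≡ᵖ e) (mk≡ᵖ f) = mk≡ᵖ (∣-resp (telescope x y z) (ℤ∣.∣m∣n⇒∣m+n e f))
      where
      telescope : ∀ x y z → (x - y) + (y - z) ≡ x - z
      telescope = solve-∀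

    +-congᵖ : ∀ {x x' y y'} → x ≡ᵖ x' → y ≡ᵖ y' → x + y ≡ᵖ x' + y'
    +-congᵖ {x} {x'} {y} {y'} (mk≡ᵖ e) (mk≡ᵖ f) = mk≡ᵖ (∣-resp (regroup x x' y y') (ℤ∣.∣m∣n⇒∣m+n e f))
      where
      regroup : ∀ x x' y y' → (x - x') + (y - y') ≡ (x + y) - (x' + y')
      regroup = solve-∀

    *-congˡᵖ : ∀ c {x y} → x ≡ᵖ y → c * x ≡ᵖ c * y
    *-congˡᵖ c {x} {y} (mk≡ᵖ e) = mk≡ᵖ (∣-resp (factor c x y) (ℤ∣.∣n⇒∣m*n c e))
      where
      factor : ∀ c x y → c * (x - y) ≡ c * x - c * y
      factor = solve-∀

    *-congʳᵖ : ∀ c {x y} → x ≡ᵖ y → x * c ≡ᵖ y * c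
    *-congʳᵖ c {x} {y} (mk≡ᵖ e) = mk≡ᵖ (∣-resp (factor c x y) (ℤ∣.∣m⇒∣m*n c e))
      where
      factor : ∀ c x y → (x - y) * c ≡ x * c - y * c
      factor = solve-∀

    ≡ᵖ-setoid : Setoid _ _
    ≡ᵖ-setoid = record
      { Carrier = ℤ ; _≈_ = _≡ᵖ_
      ; isEquivalence = record { refl = ≡⇒≡ᵖ refl ; sym = ≡ᵖ-sym ; trans = ≡ᵖ-trans } }

    module ≡ᵖ-Reasoning = SetoidReasoning ≡ᵖ-setoid

    record _≈_ (P Q : Poly) : Set where
      constructor mk≈
      field coeff-≡ᵖ : ∀ k → coeff P k ≡ᵖ coeff Q k
    open _≈_ public

    ≋⇒≈ : ∀ {P Q} → P ≋ Q → P ≈ Q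
    ≋⇒≈ e .coeff-≡ᵖ k = ≡⇒≡ᵖ (coeff-≡ e k)

    ≈-refl : ∀ {P} → P ≈ P
    ≈-refl = ≋⇒≈ ≋-refl

    ≈-sym : ∀ {P Q} → P ≈ Q → Q ≈ P
    ≈-sym e .coeff-≡ᵖ k = ≡ᵖ-sym (coeff-≡ᵖ e k)

    ≈-trans : ∀ {P Q R} → P ≈ Q → Q ≈ R → P ≈ R
    ≈-trans e f .coeff-≡ᵖ k = ≡ᵖ-trans (coeff-≡ᵖ e k) (coeff-≡ᵖ f k)

    ≈-setoid : Setoid _ _
    ≈-setoid = record
      { Carrier = Poly ; _≈_ = _≈_
      ; isEquivalence = record { refl = ≈-refl ; sym = ≈-sym ; trans = ≈-trans } }

    module ≈-Reasoning = SetoidReasoning ≈-setoid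

    ⊕-congᵖ : ∀ {P P' Q Q'} → P ≈ P' → Q ≈ Q' → P ⊕ Q ≈ P' ⊕ Q'
    ⊕-congᵖ {P} {P'} {Q} {Q'} e f .coeff-≡ᵖ k =
      subst₂ _≡ᵖ_ (sym (coeff-⊕ P Q k)) (sym (coeff-⊕ P' Q' k)) (+-congᵖ (coeff-≡ᵖ e k) (coeff-≡ᵖ f k))

    shift-congᵖ : ∀ {P Q} → P ≈ Q → shift P ≈ shift Q
    shift-congᵖ e .coeff-≡ᵖ zero    = ≡⇒≡ᵖ refl
    shift-congᵖ e .coeff-≡ᵖ (suc k) = coeff-≡ᵖ e k

    ·-congˡᵖ : ∀ {c c'} Q → c ≡ᵖ c' → c · Q ≈ c' · Q
    ·-congˡᵖ {c} {c'} Q e .coeff-≡ᵖ k =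
      subst₂ _≡ᵖ_ (sym (coeff-· c Q k)) (sym (coeff-· c' Q k)) (*-congʳᵖ (coeff Q k) e)

    ∷⊛-congᵖ : ∀ {a b} P P' Q → a ≡ᵖ b → P ⊛ Q ≈ P' ⊛ Q → (a ∷ P) ⊛ Q ≈ (b ∷ P') ⊛ Q
    ∷⊛-congᵖ {a} {b} P P' Q e f .coeff-≡ᵖ k =
      subst₂ _≡ᵖ_ (sym (coeff-∷⊛ a P Q k)) (sym (coeff-∷⊛ b P' Q k))
        (+-congᵖ (*-congʳᵖ (coeff Q k) e) (coeff-≡ᵖ (shift-congᵖ f) k))

    ⊛-zeroˡᵖ : ∀ P Q → P ≈ [] → P ⊛ Q ≈ []
    ⊛-zeroˡᵖ []      Q e = ≈-refl
    ⊛-zeroˡᵖ (a ∷ P) Q e =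
      ≈-trans (∷⊛-congᵖ P [] Q (coeff-≡ᵖ e 0) (⊛-zeroˡᵖ P Q (mk≈ λ k → coeff-≡ᵖ e (suc k))))
              (≋⇒≈ (⊕-cong (·-zeroˡ Q) shift-[]))

    ⊛-congˡᵖ : ∀ {P P'} Q → P ≈ P' → P ⊛ Q ≈ P' ⊛ Q
    ⊛-congˡᵖ {[]}    {P'}     Q e = ≈-sym (⊛-zeroˡᵖ P' Q (≈-sym e))
    ⊛-congˡᵖ {a ∷ P} {[]}     Q e = ⊛-zeroˡᵖ (a ∷ P) Q e
    ⊛-congˡᵖ {a ∷ P} {b ∷ P'} Q e =
      ∷⊛-congᵖ P P' Q (coeff-≡ᵖ e 0) (⊛-congˡᵖ {P} {P'} Q (mk≈ λ k → coeff-≡ᵖ e (suc k)))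

    ⊛-congᵖ : ∀ {P P' Q Q'} → P ≈ P' → Q ≈ Q' → P ⊛ Q ≈ P' ⊛ Q'
    ⊛-congᵖ {P} {P'} {Q} {Q'} e f = begin
      P ⊛ Q     ≈⟨ ⊛-congˡᵖ Q e ⟩
      P' ⊛ Q    ≈⟨ ≋⇒≈ (⊛-comm P' Q) ⟩
      Q ⊛ P'    ≈⟨ ⊛-congˡᵖ P' f ⟩
      Q' ⊛ P'   ≈⟨ ≋⇒≈ (⊛-comm Q' P') ⟩
      P' ⊛ Q'   ∎
      where open ≈-Reasoning

    ^ₚ-congᵖ : ∀ {P Q} n → P ≈ Q → P ^ₚ n ≈ Q ^ₚ n
    ^ₚ-congᵖ zero    e = ≈-refl
    ^ₚ-congᵖ (suc n) e = ⊛-congᵖ e (^ₚ-congᵖ n e)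

    ℕ∣⇒≡ᵖ0 : ∀ {n} → p ∣ n → + n ≡ᵖ + 0
    ℕ∣⇒≡ᵖ0 p∣n = ∣⇒≡ᵖ0 (ℤ∣.∣ᵤ⇒∣ p∣n)

    coeff-X-1^≡ᵖ-off-diagonal : ∀ L k → suc k ≢ L → p ∣ L C suc k →
                                coeff (X-1 ^ₚ L) (suc k) ≡ᵖ coeff (X ^ₚ L ⊕ const (- + 1)) (suc k)
    coeff-X-1^≡ᵖ-off-diagonal L k k≢L p∣LCk = begin
      coeff (X-1 ^ₚ L) (suc k)                  ≡⟨ coeff-X-1^ L (suc k) ⟩
      σ * + (L C suc k)                         ≈⟨ *-congˡᵖ σ (ℕ∣⇒≡ᵖ0 p∣LCk) ⟩
      σ * + 0                                   ≡⟨ ℤP.*-zeroʳ σ ⟩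
      + 0                                       ≡⟨ cong (_+ + 0) (coeff-X^-off-diagonal L (suc k) k≢L) ⟨
      coeff (X ^ₚ L) (suc k) + + 0              ≡⟨ coeff-⊕ (X ^ₚ L) (const (- + 1)) (suc k) ⟨
      coeff (X ^ₚ L ⊕ const (- + 1)) (suc k)    ∎
      where
      open ≡ᵖ-Reasoning
      σ = -1^ (L ℕ.+ suc k)

    X-1^≈X^-1 : ∀ L → .{{ℕ.NonZero L}} → -1^ L ≡ -1ℤ → (∀ j → 0 < j → j < L → p ∣ L C j) →
                X-1 ^ₚ L ≈ X ^ₚ L ⊕ const (- + 1)
    X-1^≈X^-1 L@(suc _) -1^L≡-1 p∣LCj .coeff-≡ᵖ zero = begin
      coeff (X-1 ^ₚ L) 0                  ≡⟨ coeff-X-1^ L 0 ⟩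
      -1^ (L ℕ.+ 0) * + 1                 ≡⟨ ℤP.*-identityʳ _ ⟩
      -1^ (L ℕ.+ 0)                       ≡⟨ cong -1^_ (ℕP.+-identityʳ L) ⟩
      -1^ L                               ≡⟨ -1^L≡-1 ⟩
      + 0 + - + 1                         ≡⟨ cong (_+ - + 1) (coeff-X^-off-diagonal L 0 (λ ())) ⟨
      coeff (X ^ₚ L) 0 + - + 1            ≡⟨ coeff-⊕ (X ^ₚ L) (const (- + 1)) 0 ⟨
      coeff (X ^ₚ L ⊕ const (- + 1)) 0    ∎
      where open ≡ᵖ-Reasoning
    X-1^≈X^-1 L@(suc _) -1^L≡-1 p∣LCj .coeff-≡ᵖ (suc k) with ℕP.<-cmp (suc k) L
    ... | tri< k<L k≢L _ = coeff-X-1^≡ᵖ-off-diagonal L k k≢L (p∣LCj (suc k) (s≤s z≤n) k<L)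
    ... | tri> _ k≢L L<k = coeff-X-1^≡ᵖ-off-diagonal L k k≢L (subst (p ∣_) (sym (k>n⇒nCk≡0 L<k)) (p ∣0))
    ... | tri≈ _ refl _ = begin
      coeff (X-1 ^ₚ L) L                  ≡⟨ coeff-X-1^ L L ⟩
      -1^ (L ℕ.+ L) * + (L C L)           ≡⟨ cong₂ _*_ (ℤP.^-distribˡ-+-* -1ℤ L L) (cong +_ (nCn≡1 L)) ⟩
      -1^ L * -1^ L * + 1                 ≡⟨ cong (λ σ → σ * σ * + 1) -1^L≡-1 ⟩
      + 1                                 ≡⟨ cong (_+ + 0) (coeff-X^-diagonal L) ⟨
      coeff (X ^ₚ L) L + + 0              ≡⟨ coeff-⊕ (X ^ₚ L) (const (- + 1)) L ⟨
      coeff (X ^ₚ L ⊕ const (- + 1)) L    ∎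
      where open ≡ᵖ-Reasoning

    X-1^[p^s]≈X^[p^s]-1 : Prime p → 2 < p → ∀ s → X-1 ^ₚ (p ^ s) ≈ X ^ₚ (p ^ s) ⊕ const (- + 1)
    X-1^[p^s]≈X^[p^s]-1 p-prime 2<p s =
      X-1^≈X^-1 (p ^ s) {{ℕP.m^n≢0 p s}} (-1^[p^s]≡-1 p-prime 2<p s) (p∣[p^s]Ck p-prime s)
      where instance _ = prime⇒nonZero p-prime

    Σₚ-congᵖ : ∀ {f g} n → (∀ k → k < n → f k ≈ g k) → Σₚ f n ≈ Σₚ g n
    Σₚ-congᵖ zero    f≈g = ≈-refl
    Σₚ-congᵖ (suc n) f≈g = ⊕-congᵖ (f≈g 0 (s≤s z≤n)) (Σₚ-congᵖ n (λ k k<n → f≈g (suc k) (s≤s k<n)))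

    Σₚ-≈[] : ∀ {f} n → (∀ k → f k ≈ []) → Σₚ f n ≈ []
    Σₚ-≈[] zero    f≈[] = ≈-refl
    Σₚ-≈[] (suc n) f≈[] = ⊕-congᵖ (f≈[] 0) (Σₚ-≈[] n (f≈[] ∘ suc))

    pos-*-congʳᵖ : ∀ c {a b} → + a ≡ᵖ + b → + (a ℕ.* c) ≡ᵖ + (b ℕ.* c)
    pos-*-congʳᵖ c {a} {b} a≡b = subst₂ _≡ᵖ_ (sym (ℤP.pos-* a c)) (sym (ℤP.pos-* b c)) (*-congʳᵖ (+ c) a≡b)

    module _ (p-prime : Prime p) {M : ℕ} (p∣M : p ∣ M) where

      [n+M]Ck≡ᵖnCk : ∀ n k → k < p → + ((n ℕ.+ M) C k) ≡ᵖ + (n C k)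
      [n+M]Ck≡ᵖnCk zero    zero    k<p = ≡⇒≡ᵖ refl
      [n+M]Ck≡ᵖnCk zero    (suc k) k<p = ℕ∣⇒≡ᵖ0 (∣n⇒∣nCk p-prime p∣M (s≤s z≤n) k<p)
      [n+M]Ck≡ᵖnCk (suc n) zero    k<p = ≡⇒≡ᵖ refl
      [n+M]Ck≡ᵖnCk (suc n) (suc k) k<p = begin
        + (suc (n ℕ.+ M) C suc k)                          ≡⟨ cong +_ (nCk+nC[k+1]≡[n+1]C[k+1] (n ℕ.+ M) k) ⟨
        + ((n ℕ.+ M) C k ℕ.+ (n ℕ.+ M) C suc k)            ≡⟨ ℤP.pos-+ ((n ℕ.+ M) C k) _ ⟩
        + ((n ℕ.+ M) C k) + + ((n ℕ.+ M) C suc k)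
          ≈⟨ +-congᵖ ([n+M]Ck≡ᵖnCk n k (ℕP.<-trans (ℕP.n<1+n k) k<p)) ([n+M]Ck≡ᵖnCk n (suc k) k<p) ⟩
        + (n C k) + + (n C suc k)                          ≡⟨ ℤP.pos-+ (n C k) (n C suc k) ⟨
        + (n C k ℕ.+ n C suc k)                            ≡⟨ cong +_ (nCk+nC[k+1]≡[n+1]C[k+1] n k) ⟩
        + (suc n C suc k)                                  ∎
        where open ≡ᵖ-Reasoning

      derangeCoeff-≡ᵖ : ∀ n r k → + derangeCoeff (n ℕ.+ M) r k ≡ᵖ + derangeCoeff n r k
      derangeCoeff-≡ᵖ n r k with k ℕ.<? p
      ... | yes k<p = pos-*-congʳᵖ (k !) (pos-*-congʳᵖ ((k ℕ.+ r) C k) ([n+M]Ck≡ᵖnCk n k k<p))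
      ... | no  k≮p = ≡ᵖ-trans (p∣derangeCoeff (n ℕ.+ M)) (≡ᵖ-sym (p∣derangeCoeff n))
        where
        instance _ = prime⇒nonZero p-prime
        p∣derangeCoeff : ∀ n → + derangeCoeff n r k ≡ᵖ + 0
        p∣derangeCoeff n = ℕ∣⇒≡ᵖ0 (∣n⇒∣m*n ((n C k) ℕ.* ((k ℕ.+ r) C k)) (m≤n⇒m∣n! (ℕP.≮⇒≥ k≮p)))

      derangeTerm-shift : ∀ n r k → k ≤ n → derangeTerm (n ℕ.+ M) r k ≈ X-1 ^ₚ M ⊛ derangeTerm n r k
      derangeTerm-shift n r k k≤n = begin
        + derangeCoeff (n ℕ.+ M) r k · X-1 ^ₚ (n ℕ.+ M ∸ k)    ≈⟨ ·-congˡᵖ _ (derangeCoeff-≡ᵖ n r k) ⟩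
        c · X-1 ^ₚ (n ℕ.+ M ∸ k)                               ≡⟨ cong (λ e → c · X-1 ^ₚ e) (ℕP.+-∸-comm M k≤n) ⟩
        c · X-1 ^ₚ ((n ∸ k) ℕ.+ M)                             ≈⟨ ≋⇒≈ (·-cong c (^ₚ-distribˡ-+-⊛ X-1 (n ∸ k) M)) ⟩
        c · (X-1 ^ₚ (n ∸ k) ⊛ X-1 ^ₚ M)                       ≈⟨ ≋⇒≈ (·-cong c (⊛-comm (X-1 ^ₚ (n ∸ k)) (X-1 ^ₚ M))) ⟩
        c · (X-1 ^ₚ M ⊛ X-1 ^ₚ (n ∸ k))                       ≈⟨ ≋⇒≈ (≋-sym (⊛-· c (X-1 ^ₚ M) (X-1 ^ₚ (n ∸ k)))) ⟩
        X-1 ^ₚ M ⊛ (c · X-1 ^ₚ (n ∸ k))                       ∎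
        where
        open ≈-Reasoning
        c = + derangeCoeff n r k

      derangeTerm-vanishes : ∀ n r k → n < k → derangeTerm (n ℕ.+ M) r k ≈ []
      derangeTerm-vanishes n r k n<k = begin
        + derangeCoeff (n ℕ.+ M) r k · X-1 ^ₚ (n ℕ.+ M ∸ k)    ≈⟨ ·-congˡᵖ _ (derangeCoeff-≡ᵖ n r k) ⟩
        + derangeCoeff n r k · X-1 ^ₚ (n ℕ.+ M ∸ k)            ≡⟨ cong (λ c → + c · X-1 ^ₚ (n ℕ.+ M ∸ k)) (derangeCoeff-vanishes r n<k) ⟩
        + 0 · X-1 ^ₚ (n ℕ.+ M ∸ k)                             ≈⟨ ≋⇒≈ (·-zeroˡ _) ⟩
        []                                                     ∎
        where open ≈-Reasoning

      derangePoly-+-multiple : ∀ n r → derangePoly (n ℕ.+ M) r ≈ X-1 ^ₚ M ⊛ derangePoly n r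
      derangePoly-+-multiple n r = begin
        derangePoly (n ℕ.+ M) r                                    ≡⟨ derangePoly≡Σₚ (n ℕ.+ M) r ⟩
        Σₚ (derangeTerm (n ℕ.+ M) r) (suc n ℕ.+ M)                ≈⟨ ≋⇒≈ (Σₚ-split (derangeTerm (n ℕ.+ M) r) (suc n) M) ⟩
        Σₚ (derangeTerm (n ℕ.+ M) r) (suc n) ⊕ Σₚ (λ k → derangeTerm (n ℕ.+ M) r (suc n ℕ.+ k)) M
          ≈⟨ ⊕-congᵖ (Σₚ-congᵖ (suc n) λ k k≤n → derangeTerm-shift n r k (ℕP.≤-pred k≤n))
                     (Σₚ-≈[] M λ k → derangeTerm-vanishes n r (suc n ℕ.+ k) (s≤s (ℕP.m≤m+n n k))) ⟩
        Σₚ (λ k → X-1 ^ₚ M ⊛ derangeTerm n r k) (suc n) ⊕ []      ≈⟨ ≋⇒≈ (⊕-identityʳ _) ⟩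
        Σₚ (λ k → X-1 ^ₚ M ⊛ derangeTerm n r k) (suc n)           ≈⟨ ≋⇒≈ (⊛-Σₚ (X-1 ^ₚ M) (derangeTerm n r) (suc n)) ⟨
        X-1 ^ₚ M ⊛ Σₚ (derangeTerm n r) (suc n)                   ≡⟨ cong (X-1 ^ₚ M ⊛_) (derangePoly≡Σₚ n r) ⟨
        X-1 ^ₚ M ⊛ derangePoly n r                                 ∎
        where open ≈-Reasoning

open import Data.Nat using (_+_; _*_; _≥_)
open import Data.Integer using (-_; +_)

corollary4 : (r n s m p : ℕ) → n ≥ 1 → s ≥ 1 → Prime p → p ≥ 3 →
    derangePoly (n + m * p ^ s) r
      ≡ₚ (((X ^ₚ (p ^ s)) ⊕ const (- (+ 1))) ^ₚ m) ⊛ derangePoly n r [mod p ]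
corollary4 r n zero m p _ () _ _
-- The congruence holds for n = 0 as well.
corollary4 r n s@(suc s-1) m p _ _ p-prime p≥3 k = ℤ∣.∣⇒∣ᵤ (p∣difference (coeff-≡ᵖ congruence k))
  where
  open Modulo p
  congruence : derangePoly (n + m * p ^ s) r ≈ (X ^ₚ (p ^ s) ⊕ const (- + 1)) ^ₚ m ⊛ derangePoly n r
  congruence = begin
    derangePoly (n + m * p ^ s) r             ≈⟨ derangePoly-+-multiple p-prime (∣n⇒∣m*n m (m∣m*n (p ^ s-1))) n r ⟩
    X-1 ^ₚ (m * p ^ s) ⊛ derangePoly n r      ≈⟨ ⊛-congᵖ (≋⇒≈ (^ₚ-*-assoc X-1 m (p ^ s))) ≈-refl ⟩
    (X-1 ^ₚ (p ^ s)) ^ₚ m ⊛ derangePoly n r   ≈⟨ ⊛-congᵖ (^ₚ-congᵖ m (X-1^[p^s]≈X^[p^s]-1 p-prime p≥3 s)) ≈-refl ⟩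
    (X ^ₚ (p ^ s) ⊕ const (- + 1)) ^ₚ m ⊛ derangePoly n r ∎
    where open ≈-Reasoning
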